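{- In the setting described in the context, let $w$ be an endpoint of an $M$-$M^*$-path. Then $d_G(w)\ge 2$.
   Context: Let $G=(V,E)$ be a finite simple graph. A min-degree greedy algorithm proceeds in steps on a current graph (initially $G$): in each step, if the current graph has an edge, it chooses a node $u$ of minimum degree among the non-isolated nodes of the current graph, chooses any neighbor $v$ of $u$ in the current graph, adds $\{u,v\}$ to $M$ (initially empty), and deletes $u$, $v$ and all their incident edges; otherwise it stops. (MinGreedy is the special case with uniformly random choices; ties may be arbitrary here.) Let $M$ be the resulting matching, and $d_G(x)$ the degree of $x$ in $G$. Fix a maximum matching $M^*$ of $G$ such that every connected component $X$ of the graph $(V,M\cup M^*)$ having at least one edge is either a single edge belonging to $M\cap M^*$, or a path consisting of $m_X\ge 1$ edges of $M$ and $m_X+1$ edges of $M^*$ that alternate, whose first and last edges are in $M^*$; the latter components are called $M$-$M^*$-paths, and their two end nodes are not covered by $M$. -}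

module Defs where

open import Data.Nat using (ℕ; _≤_; _<_)
open import Data.Bool using (Bool; true; false; _∧_; not; if_then_else_)
open import Data.Fin using (Fin; _≟_)
open import Data.List using (List; []; _∷_; length; map; allFin; concatMap; head; last)
open import Data.List.Membership.Propositional using (_∈_)
open import Data.List.Relation.Unary.All using (All)
open import Data.List.Relation.Unary.Unique.Propositional using (Unique)
open import Data.Product using (_×_; _,_; ∃)
open import Data.Sum using (_⊎_)
open import Data.Maybe using (just)
open import Data.Nat.ListAction using (sum)
open import Relation.Binary.PropositionalEquality using (_≡_)
open import Relation.Nullary.Decidable using (⌊_⌋)

record Graph (n : ℕ) : Set where
  field
    adj    : Fin n → Fin n → Bool
    sym    : ∀ x y → adj x y ≡ adj y x
    irrefl : ∀ x → adj x x ≡ false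
open Graph public

-- A "current graph" is the subgraph of G induced by the alive vertices.
Alive : ℕ → Set
Alive n = Fin n → Bool

deg : ∀ {n} → Graph n → Alive n → Fin n → ℕ
deg {n} G alive x = sum (map (λ y → if alive y ∧ adj G x y then 1 else 0) (allFin n))

degG : ∀ {n} → Graph n → Fin n → ℕ
degG G x = deg G (λ _ → true) x

remove : ∀ {n} → Alive n → Fin n → Fin n → Alive n
remove alive u v x = alive x ∧ not ⌊ x ≟ u ⌋ ∧ not ⌊ x ≟ v ⌋

-- Run G alive M : some execution of the min-degree greedy algorithm
-- (arbitrary tie-breaking) started on the current graph induced by
-- 'alive' outputs the matching M (list of chosen pairs (u , v)).
data Run {n : ℕ} (G : Graph n) : Alive n → List (Fin n × Fin n) → Set where
  stop : ∀ {alive} →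
         (∀ x y → alive x ≡ true → alive y ≡ true → adj G x y ≡ false) →
         Run G alive []
  step : ∀ {alive M} (u v : Fin n) →
         alive u ≡ true → alive v ≡ true → adj G u v ≡ true →
         (∀ x → alive x ≡ true → 0 < deg G alive x → deg G alive u ≤ deg G alive x) →
         Run G (remove alive u v) M →
         Run G alive ((u , v) ∷ M)

GreedyOutput : ∀ {n} → Graph n → List (Fin n × Fin n) → Set
GreedyOutput G M = Run G (λ _ → true) M

InE : ∀ {n} → List (Fin n × Fin n) → Fin n → Fin n → Set
InE L a b = (a , b) ∈ L ⊎ (b , a) ∈ L

ends : ∀ {n} → List (Fin n × Fin n) → List (Fin n)
ends = concatMap (λ { (a , b) → a ∷ b ∷ [] })

IsMatching : ∀ {n} → Graph n → List (Fin n × Fin n) → Set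
IsMatching G L = All (λ { (a , b) → adj G a b ≡ true }) L × Unique (ends L)

IsMaximumMatching : ∀ {n} → Graph n → List (Fin n × Fin n) → Set
IsMaximumMatching G L =
  IsMatching G L × (∀ L' → IsMatching G L' → length L' ≤ length L)

InUnion : ∀ {n} → List (Fin n × Fin n) → List (Fin n × Fin n) → Fin n → Fin n → Set
InUnion M Ms a b = InE M a b ⊎ InE Ms a b

consec : ∀ {A : Set} → List A → List (A × A)
consec (a ∷ b ∷ r) = (a , b) ∷ consec (b ∷ r)
consec _ = []

data Alt {n : ℕ} (M Ms : List (Fin n × Fin n)) : List (Fin n) → Set where
  last-edge : ∀ {a b} → InE Ms a b → Alt M Ms (a ∷ b ∷ [])
  more      : ∀ {a b c r} → InE Ms a b → InE M b c → Alt M Ms (c ∷ r) →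
              Alt M Ms (a ∷ b ∷ c ∷ r)

-- vs is (the vertex sequence of) an M-M*-path: a path of distinct nodes with
-- m ≥ 1 edges of M and m+1 edges of M*, alternating, first and last in M*,
-- which forms a whole connected component of (V, M ∪ M*): every edge of
-- M ∪ M* at a node of vs is an edge of the path.
IsMMsPath : ∀ {n} → List (Fin n × Fin n) → List (Fin n × Fin n) → List (Fin n) → Set
IsMMsPath M Ms vs =
  Alt M Ms vs × 4 ≤ length vs × Unique vs ×
  (∀ x y → x ∈ vs → InUnion M Ms x y → InE (consec vs) x y)

IsEndpoint : ∀ {n} → Fin n → List (Fin n) → Set
IsEndpoint w vs = head vs ≡ just w ⊎ last vs ≡ just w

ComponentStructure : ∀ {n} → List (Fin n × Fin n) → List (Fin n × Fin n) → Set
ComponentStructure M Ms =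
  ∀ a b → InUnion M Ms a b →
    (InE M a b × InE Ms a b) ⊎ (∃ λ vs → IsMMsPath M Ms vs × a ∈ vs)

-- Follow the greedy run up to the first step that deletes a node of the M-M*-path P.
-- Until then all of P is alive, so the run has not stopped (w is adjacent to its
-- M*-neighbour on P) and w has current degree at least 1. The edge {u,v} taken at that
-- step lies in M and meets P, hence is an edge of P, since P is a whole component of
-- M ∪ M*. It cannot be an M*-edge of P: one of its ends would have a second M-partner,
-- but the greedy output is a matching. So it is an M-edge of P, u is an inner node of P
-- and has a second live neighbour, its M*-neighbour; minimality of u then gives
-- 2 ≤ deg u ≤ deg w ≤ d_G(w). The argument applies to every node of P and uses of M*
-- only that its edges lie in G.

module Submission where

open import Defs
open import Data.Nat using (ℕ; _≤_; _+_; z≤n; s≤s)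
open import Data.Nat.Properties using (module ≤-Reasoning; ≤-refl; ≤-trans; ≤-reflexive; m≤m+n; m≤n+m; +-comm; +-monoʳ-≤; +-mono-≤)
open import Data.Nat.ListAction using (sum)
open import Data.Bool using (true; false; _∧_; if_then_else_)
open import Data.Fin using (Fin; _≟_)
open import Data.List using (List; []; _∷_; map; allFin; head; last)
open import Data.List.Membership.Propositional using (_∈_)
open import Data.List.Membership.Propositional.Properties using (∈-allFin)
import Data.List.Membership.DecPropositional as DecMembership
open import Data.List.Relation.Binary.Subset.Propositional using (_⊆_)
open import Data.List.Relation.Unary.Any using (here; there)
open import Data.List.Relation.Unary.All as All using ()
open import Data.List.Relation.Unary.AllPairs using (_∷_)
open import Data.List.Relation.Unary.Unique.Propositional using (Unique)
open import Data.Product using (_×_; _,_; ∃; proj₁; proj₂)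
open import Data.Sum using (_⊎_; inj₁; inj₂; [_,_])
open import Data.Empty using (⊥-elim)
open import Relation.Nullary using (yes; no)
open import Relation.Nullary.Decidable using (_⊎-dec_)
open import Function using (_∘_; id)
open import Relation.Binary.PropositionalEquality as ≡ using (_≡_; _≢_; refl; trans; subst; cong₂)
open import Data.Maybe using (just)

sum-map-mono : ∀ {A : Set} {f g : A → ℕ} (xs : List A) →
               (∀ x → f x ≤ g x) → sum (map f xs) ≤ sum (map g xs)
sum-map-mono []       f≤g = z≤n
sum-map-mono (x ∷ xs) f≤g = +-mono-≤ (f≤g x) (sum-map-mono xs f≤g)

∈⇒≤sum-map : ∀ {A : Set} (f : A → ℕ) {x xs} → x ∈ xs → f x ≤ sum (map f xs)
∈⇒≤sum-map f {xs = y ∷ xs} (here refl) = m≤m+n (f y) _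
∈⇒≤sum-map f {xs = y ∷ xs} (there x∈) = ≤-trans (∈⇒≤sum-map f x∈) (m≤n+m _ (f y))

∈≢∈⇒+≤sum-map : ∀ {A : Set} (f : A → ℕ) {x y xs} → x ∈ xs → y ∈ xs → x ≢ y →
                f x + f y ≤ sum (map f xs)
∈≢∈⇒+≤sum-map f (here refl) (here refl) x≢y = ⊥-elim (x≢y refl)
∈≢∈⇒+≤sum-map f {z} (here refl) (there y∈) _ = +-monoʳ-≤ (f z) (∈⇒≤sum-map f y∈)
∈≢∈⇒+≤sum-map f {x} {z} (there x∈) (here refl) _ =
  ≤-trans (≤-reflexive (+-comm (f x) (f z))) (+-monoʳ-≤ (f z) (∈⇒≤sum-map f x∈))
∈≢∈⇒+≤sum-map f {xs = z ∷ _} (there x∈) (there y∈) x≢y =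
  ≤-trans (∈≢∈⇒+≤sum-map f x∈ y∈ x≢y) (m≤n+m _ (f z))

consec⇒∈ : ∀ {A : Set} (vs : List A) {a b} → (a , b) ∈ consec vs → a ∈ vs × b ∈ vs
consec⇒∈ (x ∷ y ∷ r) (here refl) = here refl , there (here refl)
consec⇒∈ (x ∷ y ∷ r) (there ab∈) =
  let a∈ , b∈ = consec⇒∈ (y ∷ r) ab∈ in there a∈ , there b∈

head⇒∈ : ∀ {A : Set} (vs : List A) {w} → head vs ≡ just w → w ∈ vs
head⇒∈ (x ∷ vs) refl = here refl

last⇒∈ : ∀ {A : Set} (vs : List A) {w} → last vs ≡ just w → w ∈ vs
last⇒∈ (x ∷ [])     refl   = here refl
last⇒∈ (x ∷ y ∷ ys) last≡w = there (last⇒∈ (y ∷ ys) last≡w)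

module _ {n : ℕ} (G : Graph n) where

  private
    counts : Alive n → Fin n → Fin n → ℕ
    counts alive x y = if alive y ∧ adj G x y then 1 else 0

    counts-mono : ∀ {alive alive′} → (∀ {y} → alive y ≡ true → alive′ y ≡ true) →
                  ∀ x y → counts alive x y ≤ counts alive′ x y
    counts-mono {alive} alive⊆ x y with alive y in eq
    ... | false = z≤n
    ... | true rewrite alive⊆ eq = ≤-refl

    counts-neighbour : ∀ alive {x y} → alive y ≡ true → adj G x y ≡ true → counts alive x y ≡ 1
    counts-neighbour _ y-alive xy-edge rewrite y-alive | xy-edge = refl

  deg-mono : ∀ {alive alive′} → (∀ {y} → alive y ≡ true → alive′ y ≡ true) →
             ∀ x → deg G alive x ≤ deg G alive′ x
  deg-mono alive⊆ x = sum-map-mono (allFin n) (counts-mono alive⊆ x)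

  neighbour⇒1≤deg : ∀ {alive x y} → alive y ≡ true → adj G x y ≡ true → 1 ≤ deg G alive x
  neighbour⇒1≤deg {alive} {x} {y} y-alive xy-edge =
    subst (_≤ deg G alive x) (counts-neighbour alive y-alive xy-edge)
          (∈⇒≤sum-map (counts alive x) (∈-allFin y))

  neighbours⇒2≤deg : ∀ {alive x y z} → y ≢ z →
                     alive y ≡ true → adj G x y ≡ true → alive z ≡ true → adj G x z ≡ true →
                     2 ≤ deg G alive x
  neighbours⇒2≤deg {alive} {x} {y} {z} y≢z y-alive xy-edge z-alive xz-edge =
    subst (_≤ deg G alive x)
          (cong₂ _+_ (counts-neighbour alive y-alive xy-edge) (counts-neighbour alive z-alive xz-edge))
          (∈≢∈⇒+≤sum-map (counts alive x) (∈-allFin y) (∈-allFin z) y≢z)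

module _ {n : ℕ} (alive : Alive n) (u v : Fin n) where

  remove⁺ : ∀ {x} → alive x ≡ true → x ≢ u → x ≢ v → remove alive u v x ≡ true
  remove⁺ {x} x-alive x≢u x≢v rewrite x-alive with x ≟ u | x ≟ v
  ... | yes x≡u | _       = ⊥-elim (x≢u x≡u)
  ... | no _    | yes x≡v = ⊥-elim (x≢v x≡v)
  ... | no _    | no _    = refl

  remove⁻ : ∀ {x} → remove alive u v x ≡ true → alive x ≡ true × x ≢ u × x ≢ v
  remove⁻ {x} kept with alive x | x ≟ u | x ≟ v
  remove⁻ ()   | false | _      | _
  remove⁻ ()   | true  | yes _  | _
  remove⁻ ()   | true  | no _   | yes _
  remove⁻ kept | true  | no x≢u | no x≢v = refl , x≢u , x≢v

InE-sym : ∀ {n} {L : List (Fin n × Fin n)} {a b} → InE L a b → InE L b a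
InE-sym (inj₁ ab∈) = inj₂ ab∈
InE-sym (inj₂ ba∈) = inj₁ ba∈

InE-∷⁻ : ∀ {n} {L : List (Fin n × Fin n)} {u v a b} → InE ((u , v) ∷ L) a b →
         (a ≡ u × b ≡ v) ⊎ (a ≡ v × b ≡ u) ⊎ InE L a b
InE-∷⁻ (inj₁ (here refl)) = inj₁ (refl , refl)
InE-∷⁻ (inj₂ (here refl)) = inj₂ (inj₁ (refl , refl))
InE-∷⁻ (inj₁ (there ab∈)) = inj₂ (inj₂ (inj₁ ab∈))
InE-∷⁻ (inj₂ (there ba∈)) = inj₂ (inj₂ (inj₂ ba∈))

IsMatching⇒edge : ∀ {n} (G : Graph n) {L a b} → IsMatching G L → InE L a b → adj G a b ≡ true
IsMatching⇒edge G (edges , _) (inj₁ ab∈) = All.lookup edges ab∈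
IsMatching⇒edge G {a = a} {b} (edges , _) (inj₂ ba∈) =
  trans (Graph.sym G a b) (All.lookup edges ba∈)

module _ {n : ℕ} {G : Graph n} where

  Run⇒alive : ∀ {alive L a b} → Run G alive L → InE L a b → alive a ≡ true
  Run⇒alive (stop _) (inj₁ ())
  Run⇒alive (stop _) (inj₂ ())
  Run⇒alive {alive} (step u v u-alive v-alive _ _ run) e with InE-∷⁻ e
  ... | inj₁ (refl , _)        = u-alive
  ... | inj₂ (inj₁ (refl , _)) = v-alive
  ... | inj₂ (inj₂ e′)         = proj₁ (remove⁻ alive u v (Run⇒alive run e′))

  Run⇒avoids : ∀ {alive u v L a b} → Run G alive ((u , v) ∷ L) → InE L a b → a ≢ u × a ≢ v
  Run⇒avoids {alive} (step u v _ _ _ _ run) e = proj₂ (remove⁻ alive u v (Run⇒alive run e))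

  Run⇒partner-unique : ∀ {alive L a b c} → Run G alive L → InE L a b → InE L a c → b ≡ c
  Run⇒partner-unique (stop _) (inj₁ ()) _
  Run⇒partner-unique (stop _) (inj₂ ()) _
  Run⇒partner-unique run@(step u v _ _ _ _ tail-run) e e′ with InE-∷⁻ e | InE-∷⁻ e′
  ... | inj₂ (inj₂ tail)          | inj₂ (inj₂ tail′)         = Run⇒partner-unique tail-run tail tail′
  ... | inj₁ (refl , refl)        | inj₁ (_ , refl)           = refl
  ... | inj₁ (refl , refl)        | inj₂ (inj₁ (u≡v , refl))  = ≡.sym u≡v
  ... | inj₂ (inj₁ (refl , refl)) | inj₁ (v≡u , refl)         = ≡.sym v≡u
  ... | inj₂ (inj₁ (refl , refl)) | inj₂ (inj₁ (_ , refl))    = refl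
  ... | inj₁ (refl , refl)        | inj₂ (inj₂ tail′)         = ⊥-elim (proj₁ (Run⇒avoids run tail′) refl)
  ... | inj₂ (inj₁ (refl , refl)) | inj₂ (inj₂ tail′)         = ⊥-elim (proj₂ (Run⇒avoids run tail′) refl)
  ... | inj₂ (inj₂ tail)          | inj₁ (refl , _)           = ⊥-elim (proj₁ (Run⇒avoids run tail) refl)
  ... | inj₂ (inj₂ tail)          | inj₂ (inj₁ (refl , _))    = ⊥-elim (proj₂ (Run⇒avoids run tail) refl)

module _ {n : ℕ} (M Ms : List (Fin n × Fin n)) where

  OtherMsNeighbour : Fin n → Fin n → Set
  OtherMsNeighbour a b = ∃ λ z → InE Ms a z × z ≢ b

  OtherMPartner : Fin n → Fin n → Set
  OtherMPartner a b = ∃ λ t → InE M a t × t ≢ b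

  EdgeCases : Fin n → Fin n → Set
  EdgeCases a b = (OtherMsNeighbour a b × OtherMsNeighbour b a) ⊎ OtherMPartner a b ⊎ OtherMPartner b a

  EdgeCases-sym : ∀ {a b} → EdgeCases a b → EdgeCases b a
  EdgeCases-sym (inj₁ (a-side , b-side)) = inj₁ (b-side , a-side)
  EdgeCases-sym (inj₂ (inj₁ a-partner))  = inj₂ (inj₂ a-partner)
  EdgeCases-sym (inj₂ (inj₂ b-partner))  = inj₂ (inj₁ b-partner)

  Alt⇒Ms-neighbour : ∀ {vs y} → Alt M Ms vs → y ∈ vs → ∃ λ z → InE Ms y z
  Alt⇒Ms-neighbour (last-edge ab) (here refl)         = _ , ab
  Alt⇒Ms-neighbour (last-edge ab) (there (here refl)) = _ , InE-sym ab
  Alt⇒Ms-neighbour (more ab _ _)  (here refl)         = _ , ab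
  Alt⇒Ms-neighbour (more ab _ _)  (there (here refl)) = _ , InE-sym ab
  Alt⇒Ms-neighbour (more _ _ alt) (there (there y∈))  = Alt⇒Ms-neighbour alt y∈

  Alt⇒first-Ms-edge : ∀ {c r} → Alt M Ms (c ∷ r) → ∃ λ d → InE Ms c d × d ∈ r
  Alt⇒first-Ms-edge (last-edge cd) = _ , cd , here refl
  Alt⇒first-Ms-edge (more cd _ _)  = _ , cd , here refl

  -- The third argument covers the final M*-edge: in the recursion its first node is
  -- M-matched to the preceding node of the path.
  Alt⇒EdgeCases : ∀ {vs} → Alt M Ms vs → Unique vs →
                  (∀ {a b} → vs ≡ a ∷ b ∷ [] → OtherMPartner a b) →
                  ∀ {a b} → (a , b) ∈ consec vs → EdgeCases a b
  Alt⇒EdgeCases (last-edge _) _ single (here refl) = inj₂ (inj₁ (single refl))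
  Alt⇒EdgeCases (more {c = c} _ bc _) (a∉ ∷ _) _ (here refl) =
    inj₂ (inj₂ (c , bc , ≡.≢-sym (All.lookup a∉ (there (here refl)))))
  Alt⇒EdgeCases (more {a} ab _ alt) (a∉ ∷ b∉ ∷ _) _ (there (here refl)) =
    let d , cd , d∈ = Alt⇒first-Ms-edge alt in
    inj₁ ( (a , InE-sym ab , All.lookup a∉ (there (here refl)))
         , (d , cd , ≡.≢-sym (All.lookup b∉ (there d∈))))
  Alt⇒EdgeCases (more {b = b} {c} _ bc alt) (_ ∷ b∉ ∷ unique) _ (there (there ab∈)) =
    Alt⇒EdgeCases alt unique preceded ab∈
    where
    preceded : ∀ {c′ d} → c ∷ _ ≡ c′ ∷ d ∷ [] → OtherMPartner c′ d
    preceded refl = b , InE-sym bc , All.lookup b∉ (there (here refl))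

module _ {n : ℕ} (G : Graph n) (M Ms : List (Fin n × Fin n))
         (Ms⊆E : ∀ {a b} → InE Ms a b → adj G a b ≡ true)
         (M-partner-unique : ∀ {a b c} → InE M a b → InE M a c → b ≡ c)
         {vs : List (Fin n)} (path : IsMMsPath M Ms vs) where

  open DecMembership (_≟_ {n}) using (_∈?_)

  private
    alt : Alt M Ms vs
    alt = proj₁ path

    unique : Unique vs
    unique = proj₁ (proj₂ (proj₂ path))

    closed : ∀ x y → x ∈ vs → InUnion M Ms x y → InE (consec vs) x y
    closed = proj₂ (proj₂ (proj₂ path))

  closed⇒∈ : ∀ {y z} → y ∈ vs → InUnion M Ms y z → z ∈ vs
  closed⇒∈ {y} {z} y∈ yz with closed y z y∈ yz
  ... | inj₁ yz∈ = proj₂ (consec⇒∈ vs yz∈)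
  ... | inj₂ zy∈ = proj₁ (consec⇒∈ vs zy∈)

  Ms-neighbour-on-path : ∀ {y} → y ∈ vs → ∃ λ z → InE Ms y z × z ∈ vs
  Ms-neighbour-on-path y∈ =
    let z , yz = Alt⇒Ms-neighbour M Ms alt y∈ in z , yz , closed⇒∈ y∈ (inj₂ yz)

  consec⇒EdgeCases : ∀ {a b} → InE (consec vs) a b → EdgeCases M Ms a b
  consec⇒EdgeCases (inj₁ ab∈) = Alt⇒EdgeCases M Ms alt unique not-single ab∈
    where
    not-single : ∀ {a b} → vs ≡ a ∷ b ∷ [] → OtherMPartner M Ms a b
    not-single refl with proj₁ (proj₂ path)
    ... | s≤s (s≤s ())
  consec⇒EdgeCases (inj₂ ba∈) = EdgeCases-sym M Ms (consec⇒EdgeCases (inj₁ ba∈))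

  M-edge-at-path⇒consec : ∀ {u v} → (u , v) ∈ M → u ∈ vs ⊎ v ∈ vs → InE (consec vs) u v
  M-edge-at-path⇒consec {u} {v} uv∈M (inj₁ u∈) = closed u v u∈ (inj₁ (inj₁ uv∈M))
  M-edge-at-path⇒consec {u} {v} uv∈M (inj₂ v∈) = InE-sym (closed v u v∈ (inj₁ (inj₂ uv∈M)))

  M-edge-at-path⇒OtherMsNeighbour : ∀ {u v} → (u , v) ∈ M → u ∈ vs ⊎ v ∈ vs → OtherMsNeighbour M Ms u v
  M-edge-at-path⇒OtherMsNeighbour uv∈M touches with consec⇒EdgeCases (M-edge-at-path⇒consec uv∈M touches)
  ... | inj₁ (u-side , _)          = u-side
  ... | inj₂ (inj₁ (t , ut , t≢v)) = ⊥-elim (t≢v (M-partner-unique ut (inj₁ uv∈M)))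
  ... | inj₂ (inj₂ (t , vt , t≢u)) = ⊥-elim (t≢u (M-partner-unique vt (inj₂ uv∈M)))

  path-alive⇒2≤deg : ∀ {alive L w} → Run G alive L → L ⊆ M →
                     (∀ {y} → y ∈ vs → alive y ≡ true) → w ∈ vs → 2 ≤ deg G alive w
  path-alive⇒2≤deg (stop no-edge) _ alive-on w∈
    with x , wx , x∈ ← Ms-neighbour-on-path w∈
    with () ← trans (≡.sym (no-edge _ x (alive-on w∈) (alive-on x∈))) (Ms⊆E wx)
  path-alive⇒2≤deg {alive} {w = w} (step u v _ v-alive uv-edge u-min run) L⊆M alive-on w∈
    with (u ∈? vs) ⊎-dec (v ∈? vs)
  ... | no untouched =
    ≤-trans (path-alive⇒2≤deg run (L⊆M ∘ there) still-alive w∈)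
            (deg-mono G (λ kept → proj₁ (remove⁻ alive u v kept)) w)
    where
    still-alive : ∀ {y} → y ∈ vs → remove alive u v y ≡ true
    still-alive y∈ = remove⁺ alive u v (alive-on y∈)
                       (λ { refl → untouched (inj₁ y∈) }) (λ { refl → untouched (inj₂ y∈) })
  ... | yes touched =
    let z , uz , z≢v = M-edge-at-path⇒OtherMsNeighbour (L⊆M (here refl)) touched
        x , wx , x∈  = Ms-neighbour-on-path w∈
    in begin
      2                 ≤⟨ neighbours⇒2≤deg G (≡.≢-sym z≢v) v-alive uv-edge
                              (alive-on (closed⇒∈ u∈ (inj₂ uz))) (Ms⊆E uz) ⟩
      deg G alive u     ≤⟨ u-min w (alive-on w∈) (neighbour⇒1≤deg G (alive-on x∈) (Ms⊆E wx)) ⟩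
      deg G alive w     ∎
    where
    open ≤-Reasoning
    u∈ : u ∈ vs
    u∈ = [ id , (λ v∈ → closed⇒∈ v∈ (inj₁ (inj₂ (L⊆M (here refl))))) ] touched

lemma1 : ∀ {n : ℕ} (G : Graph n) (M Ms : List (Fin n × Fin n)) →
         GreedyOutput G M → IsMaximumMatching G Ms → ComponentStructure M Ms →
         ∀ (vs : List (Fin n)) (w : Fin n) → IsMMsPath M Ms vs → IsEndpoint w vs →
         2 ≤ degG G w
lemma1 G M Ms greedy (Ms-matching , _) _ vs w path endpoint =
  path-alive⇒2≤deg G M Ms (IsMatching⇒edge G Ms-matching) (Run⇒partner-unique greedy) path
    greedy id (λ _ → refl) ([ head⇒∈ vs , last⇒∈ vs ] endpoint)
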